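{- Let $\langle\chi,\vec a\rangle$ be a loop, $\check\phi$ a quantifier-free formula over $\vec x$, and $\mathit{mf}:\mathbb Z^d\to\mathbb Q$ a function such that \[ \check\phi(\vec x)\land\chi(\vec x)\implies\mathit{mf}(\vec x)-\mathit{mf}(\vec a(\vec x))\le 1 \qquad\text{and}\qquad \check\phi(\vec x)\land\neg\chi(\vec x)\implies\mathit{mf}(\vec x)\le 0 \] hold for all $\vec x\in\mathbb Z^d$. Then the conditional acceleration technique mapping $(\langle\chi,\vec a\rangle,\check\phi)$ to \[ \vec x'=\vec a^n(\vec x)\land n<\mathit{mf}(\vec x)+1 \] is sound; i.e., for all $\vec x,\vec x'\in\mathbb Z^d$ and $n>0$, if $\vec x\longrightarrow^n_{\langle\check\phi,\vec a\rangle}\vec x'$ and $\vec x'=\vec a^n(\vec x)\land n<\mathit{mf}(\vec x)+1$, then $\vec x\longrightarrow^n_{\langle\chi,\vec a\rangle}\vec x'$.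
   Context: Fix $d\ge 1$, integer variables $\vec x=(x_1,\dots,x_d)$, $\vec x'$, and $n$ ranging over $\mathbb N$. A loop $\langle\chi,\vec a\rangle$ consists of a quantifier-free formula $\chi$ over atoms $p>0$ ($p$ an arithmetic expression over $\vec x$, integer semantics) and a map $\vec a:\mathbb Z^d\to\mathbb Z^d$ given by expressions over $\vec x$; $\vec a^m$ is $m$-fold application. $\vec x\longrightarrow_{\langle\chi,\vec a\rangle}\vec x'$ iff $\chi(\vec x)\land\vec x'=\vec a(\vec x)$, and $\longrightarrow^m$ is its $m$-fold composition; thus $\vec x\longrightarrow^m_{\langle\chi,\vec a\rangle}\vec x'$ iff $\vec x'=\vec a^m(\vec x)$ and $\chi(\vec a^i(\vec x))$ for all $0\le i<m$. -}

module Defs where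

open import Data.Nat using (ℕ; zero; suc)
open import Data.Integer using (ℤ; _+_; _*_; -_; _>_; +_)
open import Data.Fin using (Fin)
open import Data.Vec using (Vec; lookup; map)
open import Data.Product using (_×_)
open import Data.Sum using (_⊎_)
open import Relation.Nullary using (¬_)
open import Relation.Binary.PropositionalEquality using (_≡_)

data Expr (d : ℕ) : Set where
  var  : Fin d → Expr d
  const : ℤ → Expr d
  _⊕_  : Expr d → Expr d → Expr d
  _⊗_  : Expr d → Expr d → Expr d
  neg  : Expr d → Expr d

evalE : ∀ {d} → Expr d → Vec ℤ d → ℤ
evalE (var i) x = lookup x i
evalE (const c) x = c
evalE (e ⊕ f) x = evalE e x + evalE f x
evalE (e ⊗ f) x = evalE e x * evalE f x
evalE (neg e) x = - evalE e x

data Formula (d : ℕ) : Set where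
  pos  : Expr d → Formula d
  ¬ᶠ_  : Formula d → Formula d
  _∧ᶠ_ : Formula d → Formula d → Formula d
  _∨ᶠ_ : Formula d → Formula d → Formula d

⟦_⟧ : ∀ {d} → Formula d → Vec ℤ d → Set
⟦ pos p ⟧ x = evalE p x > + 0
⟦ ¬ᶠ φ ⟧ x = ¬ ⟦ φ ⟧ x
⟦ φ ∧ᶠ ψ ⟧ x = ⟦ φ ⟧ x × ⟦ ψ ⟧ x
⟦ φ ∨ᶠ ψ ⟧ x = ⟦ φ ⟧ x ⊎ ⟦ ψ ⟧ x

Update : ℕ → Set
Update d = Vec (Expr d) d

apply : ∀ {d} → Update d → Vec ℤ d → Vec ℤ d
apply a x = map (λ e → evalE e x) a

iter : ∀ {d} → Update d → ℕ → Vec ℤ d → Vec ℤ d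
iter a zero x = x
iter a (suc m) x = apply a (iter a m x)

record Loop (d : ℕ) : Set where
  constructor ⟨_,_⟩
  field
    guard  : Formula d
    update : Update d
open Loop public

_⟶[_]^_ : ∀ {d} → Vec ℤ d → Loop d → ℕ → Vec ℤ d → Set
(x ⟶[ L ]^ m) x' =
  (x' ≡ iter (update L) m x) × (∀ (i : ℕ) → i Data.Nat.< m → ⟦ guard L ⟧ (iter (update L) i x))

-- Along the φ-run x, a x, …, a^(n-1) x the ranking mf drops by at most 1 per
-- χ-step, so while χ has held at every earlier point, mf x ≤ mf (a^i x) + i.
-- If χ failed at a^i x with i < n, then mf (a^i x) ≤ 0 would give
-- mf x + 1 ≤ i + 1 ≤ n, contradicting n < mf x + 1; as the guard is
-- decidable, χ holds at every a^i x with i < n.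
module Submission where

open import Defs
open import Data.Nat using (ℕ; _>_)
open import Data.Integer using (ℤ)
open import Data.Vec using (Vec)
open import Data.Product using (_×_)
open import Relation.Nullary using (¬_)
open import Relation.Binary.PropositionalEquality using (_≡_)
open import Data.Rational using (ℚ; _-_; _≤_; _<_; _+_; 0ℚ; 1ℚ)
open import Data.Rational.Literals using (fromℤ)
open import Data.Integer using (+_)

import Data.Nat as ℕ
import Data.Nat.Properties as ℕ
open import Data.Nat.Induction using (<-rec)
import Data.Integer as ℤ
import Data.Integer.Properties as ℤ
import Data.Rational as ℚ
import Data.Rational.Properties as ℚ
import Data.Rational.Unnormalised as ℚᵘ
import Data.Rational.Unnormalised.Properties as ℚᵘ
open import Data.Product using (_,_)
open import Relation.Nullary using (Dec; yes; no; ¬?; _×-dec_; _⊎-dec_; contradiction)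
open import Relation.Unary using (Pred; Decidable)
open import Relation.Binary.PropositionalEquality using (refl; sym; cong; cong₂)

⟦_⟧? : ∀ {d} (φ : Formula d) (x : Vec ℤ d) → Dec (⟦ φ ⟧ x)
⟦ pos p ⟧? x   = + 0 ℤ.<? evalE p x
⟦ ¬ᶠ φ ⟧? x    = ¬? (⟦ φ ⟧? x)
⟦ φ ∧ᶠ ψ ⟧? x = ⟦ φ ⟧? x ×-dec ⟦ ψ ⟧? x
⟦ φ ∨ᶠ ψ ⟧? x = ⟦ φ ⟧? x ⊎-dec ⟦ ψ ⟧? x

fromℤ-homo-+ : ∀ i j → fromℤ (i ℤ.+ j) ≡ fromℤ i + fromℤ j
fromℤ-homo-+ i j = ℚ.toℚᵘ-injective (ℚᵘ.≃-sym (ℚᵘ.≃-trans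
  (ℚ.toℚᵘ-homo-+ (fromℤ i) (fromℤ j))
  (ℚᵘ.*≡* (cong (ℤ._* + 1) (cong₂ ℤ._+_ (ℤ.*-identityʳ i) (ℤ.*-identityʳ j))))))

fromℤ-mono-≤ : ∀ {i j} → i ℤ.≤ j → fromℤ i ≤ fromℤ j
fromℤ-mono-≤ i≤j = ℚ.*≤* (ℤ.*-monoʳ-≤-nonNeg (+ 1) i≤j)

p-q≤r⇒p≤q+r : ∀ p q {r} → p - q ≤ r → p ≤ q + r
p-q≤r⇒p≤q+r p q {r} p-q≤r = begin
  p               ≡⟨ sym (ℚ.+-identityʳ p) ⟩
  p + 0ℚ          ≡⟨ cong (λ z → p + z) (sym (ℚ.+-inverseˡ q)) ⟩
  p + (ℚ.- q + q) ≡⟨ sym (ℚ.+-assoc p (ℚ.- q) q) ⟩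
  (p - q) + q     ≤⟨ ℚ.+-monoˡ-≤ q p-q≤r ⟩
  r + q           ≡⟨ ℚ.+-comm r q ⟩
  q + r           ∎
  where open ℚ.≤-Reasoning

telescope-≤ : (m : ℕ → ℚ) (k : ℕ) → (∀ i → i ℕ.< k → m i - m (ℕ.suc i) ≤ 1ℚ) →
              m 0 ≤ m k + fromℤ (+ k)
telescope-≤ m ℕ.zero    drop = ℚ.≤-reflexive (sym (ℚ.+-identityʳ (m 0)))
telescope-≤ m (ℕ.suc k) drop = begin
  m 0                              ≤⟨ telescope-≤ m k (λ i i<k → drop i (ℕ.m<n⇒m<1+n i<k)) ⟩
  m k + fromℤ (+ k)                ≤⟨ ℚ.+-monoˡ-≤ (fromℤ (+ k)) (p-q≤r⇒p≤q+r (m k) (m (ℕ.suc k)) (drop k (ℕ.n<1+n k))) ⟩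
  (m (ℕ.suc k) + 1ℚ) + fromℤ (+ k) ≡⟨ ℚ.+-assoc (m (ℕ.suc k)) 1ℚ (fromℤ (+ k)) ⟩
  m (ℕ.suc k) + (1ℚ + fromℤ (+ k)) ≡⟨ cong (λ z → m (ℕ.suc k) + z) (sym (fromℤ-homo-+ (+ 1) (+ k))) ⟩
  m (ℕ.suc k) + fromℤ (+ ℕ.suc k)  ∎
  where open ℚ.≤-Reasoning

ranking⇒guard-holds : ∀ {p} (P : Pred ℕ p) → Decidable P → (m : ℕ → ℚ) (n : ℕ) →
                      (∀ i → i ℕ.< n → P i → m i - m (ℕ.suc i) ≤ 1ℚ) →
                      (∀ i → i ℕ.< n → ¬ P i → m i ≤ 0ℚ) →
                      fromℤ (+ n) < m 0 + 1ℚ →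
                      ∀ i → i ℕ.< n → P i
ranking⇒guard-holds P P? m n drop exit n<m₀+1 = <-rec (λ i → i ℕ.< n → P i) holds
  where
  holds : ∀ i → (∀ {j} → j ℕ.< i → j ℕ.< n → P j) → i ℕ.< n → P i
  holds i earlier i<n with P? i
  ... | yes Pi = Pi
  ... | no ¬Pi = contradiction n<n (ℚ.<-irrefl refl)
    where
    drop-before-i : ∀ j → j ℕ.< i → m j - m (ℕ.suc j) ≤ 1ℚ
    drop-before-i j j<i = drop j j<n (earlier j<i j<n)
      where j<n = ℕ.<-trans j<i i<n

    open ℚ.≤-Reasoning
    n<n : fromℤ (+ n) < fromℤ (+ n)
    n<n = begin-strict
      fromℤ (+ n)                   <⟨ n<m₀+1 ⟩
      m 0 + 1ℚ                      ≤⟨ ℚ.+-monoˡ-≤ 1ℚ (telescope-≤ m i drop-before-i) ⟩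
      (m i + fromℤ (+ i)) + 1ℚ      ≤⟨ ℚ.+-monoˡ-≤ 1ℚ (ℚ.+-monoˡ-≤ (fromℤ (+ i)) (exit i i<n ¬Pi)) ⟩
      (0ℚ + fromℤ (+ i)) + 1ℚ       ≡⟨ cong (λ z → z + 1ℚ) (ℚ.+-identityˡ (fromℤ (+ i))) ⟩
      fromℤ (+ i) + 1ℚ              ≡⟨ ℚ.+-comm (fromℤ (+ i)) 1ℚ ⟩
      1ℚ + fromℤ (+ i)              ≡⟨ sym (fromℤ-homo-+ (+ 1) (+ i)) ⟩
      fromℤ (+ ℕ.suc i)             ≤⟨ fromℤ-mono-≤ (ℤ.+≤+ i<n) ⟩
      fromℤ (+ n)                   ∎

theorem9 : (d : ℕ) → d > 0 → (χ : Formula d) (a : Update d) (φ : Formula d)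
    (mf : Vec ℤ d → ℚ)
    → (∀ x → ⟦ φ ⟧ x → ⟦ χ ⟧ x → mf x - mf (apply a x) ≤ 1ℚ)
    → (∀ x → ⟦ φ ⟧ x → ¬ ⟦ χ ⟧ x → mf x ≤ 0ℚ)
    → ∀ (x x' : Vec ℤ d) (n : ℕ) → n > 0
    → (x ⟶[ ⟨ φ , a ⟩ ]^ n) x'
    → (x' ≡ iter a n x) × (fromℤ (+ n) < mf x + 1ℚ)
    → (x ⟶[ ⟨ χ , a ⟩ ]^ n) x'
theorem9 d _ χ a φ mf drop exit x x' n _ (x'≡aⁿx , φ-run) (_ , n<mf+1) =
  x'≡aⁿx , ranking⇒guard-holds (λ i → ⟦ χ ⟧ (aⁱx i)) (λ i → ⟦ χ ⟧? (aⁱx i)) (λ i → mf (aⁱx i)) n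
             (λ i i<n → drop (aⁱx i) (φ-run i i<n))
             (λ i i<n → exit (aⁱx i) (φ-run i i<n))
             n<mf+1
  where
  aⁱx : ℕ → Vec ℤ d
  aⁱx i = iter a i x
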